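{- Let $G$ be a finite simple connected graph, and let $k' > k \geq 3$ be integers. If $I_1, I_2$ are independent sets of $G$ with $I_1 \rightsquigarrow_{k'} I_2$, then $I_1 \rightsquigarrow_k I_2$.
   Context: For an integer $k \ge 1$ and independent sets $I, J$ of $G$, write $I \leftrightarrow_k J$ if $|I \setminus J| = |J \setminus I| = 1$ and $\mathrm{dist}_G(u,v) \le k$, where $I \setminus J = \{u\}$ and $J \setminus I = \{v\}$. Write $I \rightsquigarrow_k J$ if there is a finite sequence $I = I_0, \dots, I_\ell = J$ ($\ell \ge 0$) of independent sets with $I_j \leftrightarrow_k I_{j+1}$ for all $j$. -}

module Defs where

open import Data.Nat using (ℕ; zero; suc; _≤_)
open import Data.Bool using (Bool; true; false)
open import Data.Fin using (Fin)
open import Data.Fin.Subset using (Subset; _∈_; _─_; ⁅_⁆)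
open import Data.Product using (Σ; ∃-syntax; _×_; _,_)
open import Relation.Binary.PropositionalEquality using (_≡_)
open import Relation.Binary.Construct.Closure.ReflexiveTransitive using (Star)

record Graph (n : ℕ) : Set where
  field
    adj    : Fin n → Fin n → Bool
    sym    : ∀ u v → adj u v ≡ adj v u
    irrefl : ∀ u → adj u u ≡ false
open Graph public

data Walk {n : ℕ} (G : Graph n) : Fin n → Fin n → ℕ → Set where
  here : ∀ {u} → Walk G u u zero
  step : ∀ {u w v ℓ} → adj G u w ≡ true → Walk G w v ℓ → Walk G u v (suc ℓ)

Connected : ∀ {n} → Graph n → Set
Connected G = ∀ u v → ∃[ ℓ ] Walk G u v ℓ

DistLe : ∀ {n} → Graph n → Fin n → Fin n → ℕ → Set
DistLe G u v k = ∃[ ℓ ] (ℓ ≤ k × Walk G u v ℓ)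

Independent : ∀ {n} → Graph n → Subset n → Set
Independent G I = ∀ u v → u ∈ I → v ∈ I → adj G u v ≡ false

IndSet : ∀ {n} → Graph n → Set
IndSet {n} G = Σ (Subset n) (Independent G)

Step : ∀ {n} (G : Graph n) (k : ℕ) → IndSet G → IndSet G → Set
Step G k (I , _) (J , _) =
  ∃[ u ] ∃[ v ] ((I ─ J ≡ ⁅ u ⁆) × (J ─ I ≡ ⁅ v ⁆) × DistLe G u v k)

Reach : ∀ {n} (G : Graph n) (k : ℕ) → IndSet G → IndSet G → Set
Reach G k = Star (Step G k)

-- Move the token from u to v along a walk u, p₁, p, … , v of length at least 2 (a shorter
-- walk is already a single step).  If u ~ v or p = v, one step of length ≤ 2 suffices, and if
-- p = u the walk shortens.  Otherwise, if some other token x of I lies in {p} ∪ N(p), first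
-- move x to v along a walk shorter by one, then u into the hole at x, at distance ≤ 3 from u;
-- u ≁ v keeps the intermediate set independent.  If there is no such x, moving u to p keeps
-- the set independent and the walk from p to v is shorter.  So every step splits into steps
-- of length ≤ 3.
module Submission where

open import Defs
open import Data.Nat using (ℕ; _+_; _<_; _≤_; z≤n; s≤s)
open import Data.Nat.Induction using (<-wellFounded)
open import Data.Nat.Properties using (≤-refl; ≤-trans; +-mono-≤; n≤1+n)
open import Data.Bool using (true; false)
open import Data.Bool.Properties using (¬-not) renaming (_≟_ to _≟ᵇ_)
open import Data.Fin using (Fin; _≟_)
open import Data.Fin.Properties using (any?)
open import Data.Fin.Subset using (Subset; _∈_; _∉_; _⊆_; _─_; _-_; _∪_; ⁅_⁆; inside; outside)
open import Data.Fin.Subset.Properties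
  using (_∈?_; ⊆-antisym; x∈⁅x⁆; x∈⁅y⁆⇒x≡y; x≢y⇒x∉⁅y⁆; x∈p∪q⁺; x∈p∪q⁻; x∈p∧x∉q⇒x∈p─q; p─q⊆p)
open import Data.Product using (Σ-syntax; _×_; _,_; proj₁)
open import Data.Sum using (_⊎_; inj₁; inj₂)
open import Data.Vec.Base using (_∷_) renaming (here to []=-here; there to []=-there)
open import Function using (_∘_)
open import Induction.WellFounded using (Acc; acc)
open import Relation.Nullary using (Dec; yes; no; ¬_; contradiction)
open import Relation.Nullary.Decidable using (_×-dec_; _⊎-dec_; ¬?)
open import Relation.Binary.PropositionalEquality using (_≡_; _≢_; refl; trans; subst)
import Relation.Binary.PropositionalEquality as ≡
open import Relation.Binary.Construct.Closure.ReflexiveTransitive using (ε; _◅_; _◅◅_; map; _⋆)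

x∈p─q⇒x∉q : ∀ {n} {x : Fin n} (p q : Subset n) → x ∈ p ─ q → x ∉ q
x∈p─q⇒x∉q (inside  ∷ p) (outside ∷ q) []=-here        ()
x∈p─q⇒x∉q (_       ∷ p) (_       ∷ q) ([]=-there x∈) ([]=-there x∈q) = x∈p─q⇒x∉q p q x∈ x∈q

module _ {n : ℕ} where

  record OnlyIn (I J : Subset n) (u : Fin n) : Set where
    field
      u∈I   : u ∈ I
      u∉J   : u ∉ J
      I-u⊆J : ∀ {i} → i ≢ u → i ∈ I → i ∈ J

  open OnlyIn public

  record Exchange (I : Subset n) (u v : Fin n) (J : Subset n) : Set where
    field
      leaving  : OnlyIn I J u
      entering : OnlyIn J I v

  open Exchange public

  private
    variable
      A B C I J K : Subset n
      a b c u v x : Fin n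

  OnlyIn⇒─≡⁅⁆ : OnlyIn I J u → I ─ J ≡ ⁅ u ⁆
  OnlyIn⇒─≡⁅⁆ {I} {J} {u} o = ⊆-antisym ⊆⁅u⁆ ⁅u⁆⊆
    where
    ⊆⁅u⁆ : I ─ J ⊆ ⁅ u ⁆
    ⊆⁅u⁆ {i} i∈I─J with i ≟ u
    ... | yes refl = x∈⁅x⁆ u
    ... | no i≢u   = contradiction (I-u⊆J o i≢u (p─q⊆p I J i∈I─J)) (x∈p─q⇒x∉q I J i∈I─J)
    ⁅u⁆⊆ : ⁅ u ⁆ ⊆ I ─ J
    ⁅u⁆⊆ i∈⁅u⁆ = subst (_∈ I ─ J) (≡.sym (x∈⁅y⁆⇒x≡y u i∈⁅u⁆)) (x∈p∧x∉q⇒x∈p─q (u∈I o) (u∉J o))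

  ─≡⁅⁆⇒OnlyIn : I ─ J ≡ ⁅ u ⁆ → OnlyIn I J u
  ─≡⁅⁆⇒OnlyIn {I} {J} {u} I─J≡⁅u⁆ = record
    { u∈I = p─q⊆p I J u∈I─J ; u∉J = x∈p─q⇒x∉q I J u∈I─J ; I-u⊆J = I-u⊆J′ }
    where
    u∈I─J : u ∈ I ─ J
    u∈I─J = subst (u ∈_) (≡.sym I─J≡⁅u⁆) (x∈⁅x⁆ u)
    I-u⊆J′ : ∀ {i} → i ≢ u → i ∈ I → i ∈ J
    I-u⊆J′ {i} i≢u i∈I with i ∈? J
    ... | yes i∈J = i∈J
    ... | no  i∉J = contradiction (x∈⁅y⁆⇒x≡y u (subst (i ∈_) I─J≡⁅u⁆ (x∈p∧x∉q⇒x∈p─q i∈I i∉J))) i≢u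

  Exchange-sym : Exchange I u v J → Exchange J v u I
  Exchange-sym ex = record { leaving = entering ex ; entering = leaving ex }

  exchange : a ∈ I → b ∉ I → Exchange I a b ((I - a) ∪ ⁅ b ⁆)
  exchange {a} {I} {b} a∈I b∉I = record
    { leaving  = record { u∈I = a∈I ; u∉J = a∉K ; I-u⊆J = I-a⊆K }
    ; entering = record { u∈I = x∈p∪q⁺ (inj₂ (x∈⁅x⁆ b)) ; u∉J = b∉I ; I-u⊆J = K-b⊆I } }
    where
    a∉K : a ∉ (I - a) ∪ ⁅ b ⁆
    a∉K a∈K with x∈p∪q⁻ (I - a) ⁅ b ⁆ a∈K
    ... | inj₁ a∈I-a = x∈p─q⇒x∉q I ⁅ a ⁆ a∈I-a (x∈⁅x⁆ a)
    ... | inj₂ a∈⁅b⁆ = b∉I (subst (_∈ I) (x∈⁅y⁆⇒x≡y b a∈⁅b⁆) a∈I)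
    I-a⊆K : ∀ {i} → i ≢ a → i ∈ I → i ∈ (I - a) ∪ ⁅ b ⁆
    I-a⊆K i≢a i∈I = x∈p∪q⁺ (inj₁ (x∈p∧x∉q⇒x∈p─q i∈I (x≢y⇒x∉⁅y⁆ i≢a)))
    K-b⊆I : ∀ {i} → i ≢ b → i ∈ (I - a) ∪ ⁅ b ⁆ → i ∈ I
    K-b⊆I i≢b i∈K with x∈p∪q⁻ (I - a) ⁅ b ⁆ i∈K
    ... | inj₁ i∈I-a = p─q⊆p I ⁅ a ⁆ i∈I-a
    ... | inj₂ i∈⁅b⁆ = contradiction (x∈⁅y⁆⇒x≡y b i∈⁅b⁆) i≢b

  ∈-Exchange : Exchange I a b K → x ∈ K → x ≡ b ⊎ (x ∈ I × x ≢ a)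
  ∈-Exchange {b = b} {x = x} ex x∈K with x ≟ b
  ... | yes x≡b = inj₁ x≡b
  ... | no  x≢b = inj₂ (I-u⊆J (entering ex) x≢b x∈K , λ { refl → u∉J (leaving ex) x∈K })

  OnlyIn-trans : OnlyIn A B a → OnlyIn B A b → OnlyIn B C b → OnlyIn C B c → a ≢ c → OnlyIn A C a
  OnlyIn-trans A-a⊆B B-b⊆A B-b⊆C C-c⊆B a≢c = record
    { u∈I   = u∈I A-a⊆B
    ; u∉J   = λ a∈C → u∉J A-a⊆B (I-u⊆J C-c⊆B a≢c a∈C)
    ; I-u⊆J = λ i≢a i∈A → I-u⊆J B-b⊆C (λ { refl → u∉J B-b⊆A i∈A }) (I-u⊆J A-a⊆B i≢a i∈A) }

  Exchange-trans : Exchange A a b B → Exchange B b c C → a ≢ c → Exchange A a c C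
  Exchange-trans ab bc a≢c = record
    { leaving  = OnlyIn-trans (leaving ab) (entering ab) (leaving bc) (entering bc) a≢c
    ; entering = OnlyIn-trans (entering bc) (leaving bc) (entering ab) (leaving ab) (a≢c ∘ ≡.sym) }

  OnlyIn-relay : OnlyIn A B b → OnlyIn B A c → OnlyIn B C a → OnlyIn C B b → a ≢ c → OnlyIn A C a
  OnlyIn-relay {A = A} {b = b} {C = C} {a = a} A-b⊆B B-c⊆A B-a⊆C C-b⊆B a≢c = record
    { u∈I   = I-u⊆J B-c⊆A a≢c (u∈I B-a⊆C)
    ; u∉J   = u∉J B-a⊆C
    ; I-u⊆J = A-a⊆C }
    where
    A-a⊆C : ∀ {i} → i ≢ a → i ∈ A → i ∈ C
    A-a⊆C {i} i≢a i∈A with i ≟ b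
    ... | yes refl = u∈I C-b⊆B
    ... | no  i≢b  = I-u⊆J B-a⊆C i≢a (I-u⊆J A-b⊆B i≢b i∈A)

  Exchange-relay : Exchange A b c B → Exchange B a b C → a ≢ c → Exchange A a c C
  Exchange-relay bc ab a≢c = record
    { leaving  = OnlyIn-relay (leaving bc) (entering bc) (leaving ab) (entering ab) a≢c
    ; entering = OnlyIn-relay (entering ab) (leaving ab) (entering bc) (leaving bc) (a≢c ∘ ≡.sym) }

module _ {n : ℕ} (G : Graph n) where

  private
    variable
      I J K : Subset n
      a b p u v w x : Fin n
      j k ℓ : ℕ

  adj-sym : adj G u v ≡ true → adj G v u ≡ true
  adj-sym {u} {v} = trans (sym G v u)

  Near : Fin n → Fin n → Set
  Near x p = x ≡ p ⊎ adj G x p ≡ true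

  near? : ∀ x p → Dec (Near x p)
  near? x p = x ≟ p ⊎-dec adj G x p ≟ᵇ true

  Near-sym : Near x p → Near p x
  Near-sym (inj₁ refl) = inj₁ refl
  Near-sym (inj₂ x~p)  = inj₂ (adj-sym x~p)

  Near⇒DistLe : Near x p → DistLe G x p 1
  Near⇒DistLe (inj₁ refl) = 0 , z≤n , here
  Near⇒DistLe (inj₂ x~p)  = 1 , ≤-refl , step x~p here

  _++ʷ_ : Walk G u w j → Walk G w v k → Walk G u v (j + k)
  here     ++ʷ q = q
  step e r ++ʷ q = step e (r ++ʷ q)

  DistLe-trans : DistLe G u w j → DistLe G w v k → DistLe G u v (j + k)
  DistLe-trans (_ , ℓ≤j , r) (_ , m≤k , q) = _ , +-mono-≤ ℓ≤j m≤k , r ++ʷ q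

  DistLe-mono : j ≤ k → DistLe G u v j → DistLe G u v k
  DistLe-mono j≤k (ℓ , ℓ≤j , w′) = ℓ , ≤-trans ℓ≤j j≤k , w′

  Independent-Exchange : Independent G I → Exchange I a b K →
                         (∀ {c} → c ∈ I → c ≢ a → adj G b c ≡ false) → Independent G K
  Independent-Exchange {b = b} indI ex b≁I i j i∈K j∈K with ∈-Exchange ex i∈K | ∈-Exchange ex j∈K
  ... | inj₁ refl          | inj₁ refl          = irrefl G b
  ... | inj₁ refl          | inj₂ (j∈I , j≢a)   = b≁I j∈I j≢a
  ... | inj₂ (i∈I , i≢a)   | inj₁ refl          = trans (sym G i b) (b≁I i∈I i≢a)
  ... | inj₂ (i∈I , _)     | inj₂ (j∈I , _)     = indI i j i∈I j∈I

  exchange-independent : Independent G I → a ∈ I → b ∉ I →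
                         (∀ {c} → c ∈ I → c ≢ a → adj G b c ≡ false) →
                         Σ[ K ∈ IndSet G ] Exchange I a b (proj₁ K)
  exchange-independent indI a∈I b∉I b≁I =
    (_ , Independent-Exchange indI (exchange a∈I b∉I) b≁I) , exchange a∈I b∉I

  exchange-via-relay : Independent G I → Independent G J → Exchange I u v J →
                       adj G u v ≢ true → x ∈ I → x ≢ u →
                       Σ[ K ∈ IndSet G ] Exchange I x v (proj₁ K) × Exchange (proj₁ K) u x J
  exchange-via-relay {I = I} {u = u} {v = v} {x = x} indI indJ I⇄J u≁v x∈I x≢u =
    let K , I⇄K = exchange-independent indI x∈I (u∉J (entering I⇄J)) v≁I-x
    in K , I⇄K , Exchange-relay (Exchange-sym I⇄K) I⇄J (x≢u ∘ ≡.sym)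
    where
    v≁I-x : ∀ {c} → c ∈ I → c ≢ x → adj G v c ≡ false
    v≁I-x {c} c∈I _ with c ≟ u
    ... | yes refl = ¬-not (u≁v ∘ adj-sym)
    ... | no  c≢u  = indJ v c (u∈I (entering I⇄J)) (I-u⊆J (leaving I⇄J) c≢u c∈I)

  exchange-via-hop : Independent G I → Exchange I u v J → p ≢ u → p ≢ v →
                     (∀ {c} → c ∈ I → c ≢ u → ¬ Near c p) →
                     Σ[ K ∈ IndSet G ] Exchange I u p (proj₁ K) × Exchange (proj₁ K) p v J
  exchange-via-hop {I = I} {u = u} {p = p} indI I⇄J p≢u p≢v p-isolated =
    let K , I⇄K = exchange-independent indI (u∈I (leaving I⇄J)) p∉I p≁I-u
    in K , I⇄K , Exchange-trans (Exchange-sym I⇄K) I⇄J p≢v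
    where
    p∉I : p ∉ I
    p∉I p∈I = p-isolated p∈I p≢u (inj₁ refl)
    p≁I-u : ∀ {c} → c ∈ I → c ≢ u → adj G p c ≡ false
    p≁I-u c∈I c≢u = ¬-not (p-isolated c∈I c≢u ∘ inj₂ ∘ adj-sym)

  exchange⇒reach : {I J : IndSet G} → Exchange (proj₁ I) u v (proj₁ J) → DistLe G u v k →
                   Reach G k I J
  exchange⇒reach I⇄J d = (_ , _ , OnlyIn⇒─≡⁅⁆ (leaving I⇄J) , OnlyIn⇒─≡⁅⁆ (entering I⇄J) , d) ◅ ε

  exchange⇒reach₃ : Acc _<_ ℓ → (indI : Independent G I) (indJ : Independent G J) →
                    Exchange I u v J → Walk G u v ℓ → Reach G 3 (I , indI) (J , indJ)
  exchange⇒reach₃ _ _ _ I⇄J w@here          = exchange⇒reach I⇄J (_ , z≤n , w)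
  exchange⇒reach₃ _ _ _ I⇄J w@(step _ here) = exchange⇒reach I⇄J (_ , s≤s z≤n , w)
  exchange⇒reach₃ {I = I} {u = u} {v} (acc rec) indI indJ I⇄J (step e₁ (step {w = p} e₂ p⇝v))
    with p ≟ u | p ≟ v | adj G u v ≟ᵇ true
       | any? (λ x → x ∈? I ×-dec ¬? (x ≟ u) ×-dec near? x p)
  ... | yes refl | _        | _       | _ =
    exchange⇒reach₃ (rec (s≤s (n≤1+n _))) indI indJ I⇄J p⇝v
  ... | no _     | yes refl | _       | _ =
    exchange⇒reach I⇄J (2 , s≤s (s≤s z≤n) , step e₁ (step e₂ here))
  ... | no _     | no _     | yes u~v | _ =
    exchange⇒reach I⇄J (1 , s≤s z≤n , step u~v here)
  ... | no _     | no _     | no u≁v  | yes (x , x∈I , x≢u , x≈p) =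
    let (K , indK) , I⇄K , K⇄J = exchange-via-relay indI indJ I⇄J u≁v x∈I x≢u
        m , m≤1+ℓ , x⇝v       = DistLe-trans (Near⇒DistLe x≈p) (_ , ≤-refl , p⇝v)
        u⇝p                   = 2 , ≤-refl , step e₁ (step e₂ here)
    in exchange⇒reach₃ (rec (s≤s m≤1+ℓ)) indI indK I⇄K x⇝v
         ◅◅ exchange⇒reach K⇄J (DistLe-trans u⇝p (Near⇒DistLe (Near-sym x≈p)))
  ... | no p≢u   | no p≢v   | no _    | no ∄x =
    let (K , indK) , I⇄K , K⇄J =
          exchange-via-hop indI I⇄J p≢u p≢v (λ c∈I c≢u c≈p → ∄x (_ , c∈I , c≢u , c≈p))
    in exchange⇒reach I⇄K (2 , s≤s (s≤s z≤n) , step e₁ (step e₂ here))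
         ◅◅ exchange⇒reach₃ (rec (s≤s (n≤1+n _))) indK indJ K⇄J p⇝v

  step⇒reach₃ : {I J : IndSet G} → Step G k I J → Reach G 3 I J
  step⇒reach₃ {I = I , indI} {J , indJ} (u , v , I─J≡⁅u⁆ , J─I≡⁅v⁆ , _ , _ , u⇝v) =
    exchange⇒reach₃ (<-wellFounded _) indI indJ I⇄J u⇝v
    where
    I⇄J : Exchange I u v J
    I⇄J = record { leaving = ─≡⁅⁆⇒OnlyIn I─J≡⁅u⁆ ; entering = ─≡⁅⁆⇒OnlyIn J─I≡⁅v⁆ }

  Reach-mono : {I J : IndSet G} → j ≤ k → Reach G j I J → Reach G k I J
  Reach-mono j≤k = map λ (u , v , I─J , J─I , d) → u , v , I─J , J─I , DistLe-mono j≤k d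

lemma1 : ∀ {n} (G : Graph n) → Connected G → (k k′ : ℕ) → 3 ≤ k → k < k′ →
    (I₁ I₂ : IndSet G) → Reach G k′ I₁ I₂ → Reach G k I₁ I₂
lemma1 G _ _ _ 3≤k _ _ _ = Reach-mono G 3≤k ∘ (step⇒reach₃ G ⋆)
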